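{- Let $k\ge 3$. For $1\le n\le k-1$, $W^{(k)}_n=W^{(k)}_{n-1}\,\big(W^{(k)}_{n-1}(n-1)^{ -1}\big)\,n$, i.e. $W^{(k)}_n$ is $W^{(k)}_{n-1}$, followed by $W^{(k)}_{n-1}$ with its last letter $n-1$ deleted, followed by the letter $n$.
   Context: The alphabet is $\mathbb{N}=\{0,1,2,\dots\}$. For an integer $k\ge 3$, $\varphi_k$ is the morphism of $\mathbb{N}^*$ defined on letters, for $i\ge 0$ and $0\le j\le k-1$, by $\varphi_k(ki+j)=(ki)(ki+j+1)$ (two letters) if $0\le j\le k-2$, and $\varphi_k(ki+k-1)=(ki+k)$ (one letter). For $n\ge 0$, $W^{(k)}_n=\varphi_k^n(0)$. For a word $W$ ending with the letter $a$, $Wa^{ -1}$ denotes $W$ with that last letter deleted. -}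

module Defs where

open import Data.Nat using (ℕ; zero; suc; _+_; _*_; _<ᵇ_; NonZero)
open import Data.Nat.DivMod using (_/_; _%_)
open import Data.List using (List; []; _∷_; _++_; concatMap)
open import Data.Bool using (if_then_else_)

-- φ_k on a letter a = k*i + j (i = a / k, j = a % k):
--   φ_k(ki+j) = (ki)(ki+j+1)  if j ≤ k-2  (i.e. j+1 < k)
--   φ_k(ki+k-1) = (ki+k)
φLetter : (k : ℕ) → .{{NonZero k}} → ℕ → List ℕ
φLetter k a =
  if (suc (a % k)) <ᵇ k
  then (k * (a / k)) ∷ (k * (a / k) + suc (a % k)) ∷ []
  else (k * (a / k) + k) ∷ []

φ : (k : ℕ) → .{{NonZero k}} → List ℕ → List ℕ
φ k = concatMap (φLetter k)

φ^ : (k : ℕ) → .{{NonZero k}} → ℕ → List ℕ → List ℕ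
φ^ k zero w = w
φ^ k (suc n) w = φ k (φ^ k n w)

W : (k : ℕ) → .{{NonZero k}} → ℕ → List ℕ
W k n = φ^ k n (0 ∷ [])

-- Below k, φ_k acts on letters as a ↦ 0 (a+1). Hence if W_n = u n and
-- W_{n+1} = W_n u (n+1), applying φ_k gives W_{n+1} = (φ_k(u) 0) (n+1) and
-- W_{n+2} = W_{n+1} (φ_k(u) 0) (n+2), so the claim propagates with u' = φ_k(u) 0.
module Submission where

open import Defs
open import Data.Nat using (ℕ; zero; suc; _≤_; _<_; NonZero)
open import Data.Nat.Properties using (<⇒<ᵇ; *-zeroʳ; <-trans; n<1+n)
open import Data.Nat.DivMod using (m<n⇒m%n≡m; m<n⇒m/n≡0)
open import Data.Bool.Properties using (T-≡)
open import Data.List using (List; []; _∷_; _++_)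
open import Data.List.Properties using (concatMap-++; ++-assoc)
open import Data.Product using (Σ; _×_; _,_)
open import Function.Bundles using (Equivalence)
open import Relation.Binary.PropositionalEquality
  using (_≡_; refl; sym; cong; module ≡-Reasoning)
open ≡-Reasoning

module _ (k : ℕ) .{{_ : NonZero k}} where

  φLetter-small : (a : ℕ) → suc a < k → φLetter k a ≡ 0 ∷ suc a ∷ []
  φLetter-small a a+1<k = go (<-trans (n<1+n a) a+1<k)
    where
    go : a < k → φLetter k a ≡ 0 ∷ suc a ∷ []
    go a<k
      rewrite m<n⇒m%n≡m {n = k} a<k
            | m<n⇒m/n≡0 {n = k} a<k
            | Equivalence.to T-≡ (<⇒<ᵇ a+1<k)
            | *-zeroʳ k = refl

  φ-++ : (xs ys : List ℕ) → φ k (xs ++ ys) ≡ φ k xs ++ φ k ys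
  φ-++ = concatMap-++ (φLetter k)

  φ-snoc-small : (u : List ℕ) (a : ℕ) → suc a < k →
    φ k (u ++ a ∷ []) ≡ (φ k u ++ 0 ∷ []) ++ suc a ∷ []
  φ-snoc-small u a a+1<k = begin
    φ k (u ++ a ∷ [])              ≡⟨ φ-++ u (a ∷ []) ⟩
    φ k u ++ φLetter k a ++ []     ≡⟨ cong (λ z → φ k u ++ z ++ []) (φLetter-small a a+1<k) ⟩
    φ k u ++ 0 ∷ suc a ∷ []        ≡⟨ sym (++-assoc (φ k u) (0 ∷ []) (suc a ∷ [])) ⟩
    (φ k u ++ 0 ∷ []) ++ suc a ∷ [] ∎

  W-step : (n : ℕ) (u : List ℕ) → suc (suc n) < k →
    W k n ≡ u ++ n ∷ [] →
    W k (suc n) ≡ W k n ++ u ++ suc n ∷ [] →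
    (W k (suc n) ≡ (φ k u ++ 0 ∷ []) ++ suc n ∷ []) ×
    (W k (suc (suc n)) ≡ W k (suc n) ++ (φ k u ++ 0 ∷ []) ++ suc (suc n) ∷ [])
  W-step n u n+2<k Wn≡ Wn+1≡ = first , second
    where
    first : W k (suc n) ≡ (φ k u ++ 0 ∷ []) ++ suc n ∷ []
    first = begin
      φ k (W k n)                      ≡⟨ cong (φ k) Wn≡ ⟩
      φ k (u ++ n ∷ [])                ≡⟨ φ-snoc-small u n (<-trans (n<1+n (suc n)) n+2<k) ⟩
      (φ k u ++ 0 ∷ []) ++ suc n ∷ []  ∎

    second : W k (suc (suc n)) ≡ W k (suc n) ++ (φ k u ++ 0 ∷ []) ++ suc (suc n) ∷ []
    second = begin
      φ k (W k (suc n))                          ≡⟨ cong (φ k) Wn+1≡ ⟩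
      φ k (W k n ++ u ++ suc n ∷ [])             ≡⟨ φ-++ (W k n) (u ++ suc n ∷ []) ⟩
      W k (suc n) ++ φ k (u ++ suc n ∷ [])       ≡⟨ cong (W k (suc n) ++_) (φ-snoc-small u (suc n) n+2<k) ⟩
      W k (suc n) ++ (φ k u ++ 0 ∷ []) ++ suc (suc n) ∷ [] ∎

lemma4p2 : (k : ℕ) → .{{_ : NonZero k}} → 3 ≤ k → (n : ℕ) → suc n < k →
    Σ (List ℕ) λ u →
      (W k n ≡ u ++ (n ∷ [])) ×
      (W k (suc n) ≡ W k n ++ u ++ (suc n ∷ []))
lemma4p2 k _ zero 1<k = [] , refl , cong (_++ []) (φLetter-small k 0 1<k)
lemma4p2 k 3≤k (suc n) n+2<k
  with lemma4p2 k 3≤k n (<-trans (n<1+n (suc n)) n+2<k)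
... | u , Wn≡ , Wn+1≡ = φ k u ++ 0 ∷ [] , W-step k n u n+2<k Wn≡ Wn+1≡
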